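{- Let $G=(B,G_1,\dots,G_k)$ be a BAB-graph whose adjacency matrix is nonsingular. Then $\mathrm{def}(G)=\mathrm{def}(B)+k$.
   Context: All graphs are finite and simple. For a graph $H$, $\mathrm{def}(H)=|V(H)|-2\mu(H)$ is the number of vertices left uncovered by a maximum matching ($\mathrm{def}$ of the empty graph is $0$). For a graph $H$, the Gallai–Edmonds sets are: $D(H)$ is the set of vertices $v$ such that some maximum matching of $H$ does not cover $v$; $A(H)$ is the set of vertices not in $D(H)$ that are adjacent to some vertex of $D(H)$; and $C(H)=V(H)\setminus(D(H)\cup A(H))$. A graph is almost bipartite if it contains exactly one odd cycle. It is König–Egerváry if $\alpha(H)+\mu(H)=|V(H)|$. Let $M$ be a matching of $H$. An $M$-blossom is an odd cycle of length $2t+1$ containing exactly $t$ edges of $M$; its base is the vertex of the cycle not covered by the $M$-edges of the cycle. An $M$-stem is an $M$-alternating path of even length (possibly $0$) from the base to a vertex not covered by $M$, sharing only the base with the blossom. An $M$-flower is the union of a blossom and a stem. BAB-graph: let $B$ be a bipartite graph (possibly empty) and $G_1,\dots,G_k$ graphs, all pairwise vertex-disjoint, where each $G_i$ is an almost bipartite non-König–Egerváry graph with unique odd cycle $C_i$, such that every vertex of $G_i$ lies in some $M$-flower of $G_i$ with blossom $C_i$ for some maximum matching $M$ of $G_i$. The graph $G$ is obtained from $B\cup G_1\cup\dots\cup G_k$ by adding edges, each joining vertices of two different graphs among $B,G_1,\dots,G_k$, such that every vertex of $B$ incident with an added edge lies in $A(B)\cup C(B)$, and every vertex of $G_i$ incident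 with an added edge lies in $A(G_i)$. It is denoted $(B,G_1,\dots,G_k)$. -}

module Defs where

open import Data.Bool using (Bool; true; false; if_then_else_; _∧_)
open import Data.Nat using (ℕ; zero; suc; _+_; _*_; _∸_; _≤_; _%_; _<ᵇ_)
open import Data.Nat.DivMod using (_mod_)
open import Data.Fin using (Fin; zero; suc; toℕ; inject₁; fromℕ; punchIn; _≟_)
open import Data.Integer using (ℤ; -_) renaming (_+_ to _+ℤ_; _*_ to _*ℤ_; +_ to ℤ+_)
open import Data.Maybe using (Maybe; just; nothing)
open import Data.Product using (Σ; _×_; _,_)
open import Data.Sum using (_⊎_)
open import Relation.Nullary using (¬_)
open import Relation.Nullary.Decidable using (⌊_⌋)
open import Relation.Binary.PropositionalEquality using (_≡_; _≢_)
open import Function.Bundles using (_⇔_)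
open import Function.Definitions using (Injective)

record Graph (n : ℕ) : Set where
  field
    adj    : Fin n → Fin n → Bool
    sym    : ∀ u v → adj u v ≡ adj v u
    irrefl : ∀ v → adj v v ≡ false
open Graph public

-- A vertex subset S; all graph notions below are taken in the induced
-- subgraph G[S].
VSet : ℕ → Set
VSet n = Fin n → Bool

full : ∀ {n} → VSet n
full _ = true

count : ∀ {n} → (Fin n → Bool) → ℕ
count {zero}  f = 0
count {suc n} f = (if f zero then 1 else 0) + count (λ i → f (suc i))

Matching : ℕ → Set
Matching n = Fin n → Maybe (Fin n)

IsMatching : ∀ {n} → Graph n → VSet n → Matching n → Set
IsMatching G S M = ∀ u v → M u ≡ just v →
  (adj G u v ≡ true) × (S u ≡ true) × (S v ≡ true) × (M v ≡ just u)

-- number of edges of M (each edge counted at its smaller endpoint)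
lowEnd : ∀ {n} → Matching n → Fin n → Bool
lowEnd M v with M v
... | just u  = toℕ v <ᵇ toℕ u
... | nothing = false

msize : ∀ {n} → Matching n → ℕ
msize M = count (lowEnd M)

IsMaxMatching : ∀ {n} → Graph n → VSet n → Matching n → Set
IsMaxMatching G S M =
  IsMatching G S M × (∀ M' → IsMatching G S M' → msize M' ≤ msize M)

-- def(H) = |V(H)| - 2 μ(H), computed from a maximum matching M of H = G[S]
deficiency : ∀ {n} → VSet n → Matching n → ℕ
deficiency S M = count S ∸ 2 * msize M

IsIndep : ∀ {n} → Graph n → VSet n → VSet n → Set
IsIndep G S I = (∀ v → I v ≡ true → S v ≡ true) ×
                (∀ u v → I u ≡ true → I v ≡ true → adj G u v ≡ false)

IsMaxIndep : ∀ {n} → Graph n → VSet n → VSet n → Set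
IsMaxIndep G S I = IsIndep G S I × (∀ I' → IsIndep G S I' → count I' ≤ count I)

KönigEgervary : ∀ {n} → Graph n → VSet n → Set
KönigEgervary G S = ∀ I M → IsMaxIndep G S I → IsMaxMatching G S M →
  count I + msize M ≡ count S

InD : ∀ {n} → Graph n → VSet n → Fin n → Set
InD G S v = (S v ≡ true) × Σ (Matching _) (λ M → IsMaxMatching G S M × (M v ≡ nothing))

InA : ∀ {n} → Graph n → VSet n → Fin n → Set
InA G S v = (S v ≡ true) × ¬ InD G S v × Σ (Fin _) (λ u → InD G S u × (adj G u v ≡ true))

InC : ∀ {n} → Graph n → VSet n → Fin n → Set
InC G S v = (S v ≡ true) × ¬ InD G S v × ¬ InA G S v

Bipartite : ∀ {n} → Graph n → VSet n → Set
Bipartite G S = Σ (Fin _ → Bool) λ col → ∀ u v → S u ≡ true → S v ≡ true →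
  adj G u v ≡ true → col u ≢ col v

-- Cycles in G[S]: vertices vtx 0, …, vtx m (length m+1 ≥ 3)

next : ∀ {m} → Fin (suc m) → Fin (suc m)
next {m} i = suc (toℕ i) mod (suc m)

record Cycle {n} (G : Graph n) (S : VSet n) : Set where
  field
    m     : ℕ
    len≥3 : 2 ≤ m
    vtx   : Fin (suc m) → Fin n
    inj   : Injective _≡_ _≡_ vtx
    inS   : ∀ i → S (vtx i) ≡ true
    adjc  : ∀ i → adj G (vtx i) (vtx (next i)) ≡ true
open Cycle public

cycLength : ∀ {n} {G : Graph n} {S} → Cycle G S → ℕ
cycLength C = suc (m C)

OddCycle : ∀ {n} {G : Graph n} {S} → Cycle G S → Set
OddCycle C = cycLength C % 2 ≡ 1

CycEdge : ∀ {n} {G : Graph n} {S} → Cycle G S → Fin n → Fin n → Set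
CycEdge C u v = Σ (Fin (suc (m C))) λ i →
  ((vtx C i ≡ u) × (vtx C (next i) ≡ v)) ⊎ ((vtx C i ≡ v) × (vtx C (next i) ≡ u))

OnCycle : ∀ {n} {G : Graph n} {S} → Cycle G S → Fin n → Set
OnCycle C v = Σ (Fin (suc (m C))) λ i → vtx C i ≡ v

-- almost bipartite with unique odd cycle C (cycles compared as subgraphs,
-- i.e. by their edge sets)
IsUniqueOddCycle : ∀ {n} (G : Graph n) (S : VSet n) → Cycle G S → Set
IsUniqueOddCycle G S C = OddCycle C ×
  (∀ (C' : Cycle G S) → OddCycle C' → ∀ u v → CycEdge C' u v ⇔ CycEdge C u v)

isPartner : ∀ {n} → Maybe (Fin n) → Fin n → Bool
isPartner (just u) v = ⌊ u ≟ v ⌋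
isPartner nothing  v = false

cycMEdges : ∀ {n} {G : Graph n} {S} → Matching n → Cycle G S → ℕ
cycMEdges M C = count (λ i → isPartner (M (vtx C i)) (vtx C (next i)))

IsBlossom : ∀ {n} {G : Graph n} {S} → Matching n → Cycle G S → Set
IsBlossom M C = 2 * cycMEdges M C + 1 ≡ cycLength C

IsBase : ∀ {n} {G : Graph n} {S} → Matching n → Cycle G S → Fin n → Set
IsBase M C b = OnCycle C b ×
  (∀ i → M (vtx C i) ≡ just (vtx C (next i)) → (vtx C i ≢ b) × (vtx C (next i) ≢ b))

-- M-alternating path p 0, …, p (2s) of even length 2s from the base b to an
-- M-uncovered vertex, meeting C only in b.  (Since the length is even and the
-- last vertex is uncovered, alternation forces edge j to be in M iff j is even.)
record Stem {n} (G : Graph n) (S : VSet n) (M : Matching n) (C : Cycle G S) (b : Fin n) : Set where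
  field
    s       : ℕ
    p       : Fin (suc (2 * s)) → Fin n
    start   : p zero ≡ b
    inj     : Injective _≡_ _≡_ p
    inS     : ∀ j → S (p j) ≡ true
    adjp    : ∀ (j : Fin (2 * s)) → adj G (p (inject₁ j)) (p (suc j)) ≡ true
    altEven : ∀ (j : Fin (2 * s)) → toℕ j % 2 ≡ 0 → M (p (inject₁ j)) ≡ just (p (suc j))
    altOdd  : ∀ (j : Fin (2 * s)) → toℕ j % 2 ≡ 1 → M (p (inject₁ j)) ≢ just (p (suc j))
    endFree : M (p (fromℕ (2 * s))) ≡ nothing
    disj    : ∀ j → OnCycle C (p j) → j ≡ zero
open Stem public

FlowerCovered : ∀ {n} (G : Graph n) (S : VSet n) → Cycle G S → Set
FlowerCovered G S C = ∀ v → S v ≡ true →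
  Σ (Matching _) λ M → IsMaxMatching G S M × IsBlossom M C ×
  Σ (Fin _) λ b → IsBase M C b ×
  Σ (Stem G S M C b) λ st → OnCycle C v ⊎ Σ (Fin (suc (2 * s st))) (λ j → p st j ≡ v)

-- BAB-graphs: vertex set of G partitioned by part : Fin n → Fin (suc k);
-- part 0 induces B, part (suc i) induces G_(i+1).

partSet : ∀ {n k} → (Fin n → Fin (suc k)) → Fin (suc k) → VSet n
partSet part c v = ⌊ part v ≟ c ⌋

record IsBAB {n} (G : Graph n) (k : ℕ) (part : Fin n → Fin (suc k)) : Set where
  field
    B-bip     : Bipartite G (partSet part zero)
    oddCyc    : (i : Fin k) → Cycle G (partSet part (suc i))
    almostBip : (i : Fin k) → IsUniqueOddCycle G (partSet part (suc i)) (oddCyc i)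
    nonKE     : (i : Fin k) → ¬ KönigEgervary G (partSet part (suc i))
    flowers   : (i : Fin k) → FlowerCovered G (partSet part (suc i)) (oddCyc i)
    crossB    : ∀ u v → adj G u v ≡ true → part u ≢ part v → part u ≡ zero →
                InA G (partSet part zero) u ⊎ InC G (partSet part zero) u
    crossG    : ∀ u v → adj G u v ≡ true → part u ≢ part v → ∀ i → part u ≡ suc i →
                InA G (partSet part (suc i)) u

adjMatrix : ∀ {n} → Graph n → Fin n → Fin n → ℤ
adjMatrix G u v = if adj G u v then ℤ+ 1 else ℤ+ 0

sgn : ℕ → ℤ
sgn zero    = ℤ+ 1
sgn (suc j) = - sgn j

sumFin : ∀ {n} → (Fin n → ℤ) → ℤ
sumFin {zero}  f = ℤ+ 0
sumFin {suc n} f = f zero +ℤ sumFin (λ i → f (suc i))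

det : ∀ {n} → (Fin n → Fin n → ℤ) → ℤ
det {zero}  A = ℤ+ 1
det {suc n} A = sumFin (λ j → sgn (toℕ j) *ℤ A zero j *ℤ det (λ i l → A (suc i) (punchIn j l)))

-- A nonsingular adjacency matrix has a nonzero term in its Laplace expansion, i.e. a
-- permutation π with v ~ π v for every vertex v.  Glue a maximum matching of B and one of
-- each G_i into a matching N of G.  For a maximum matching M of G (and likewise for π),
-- follow the alternating walk z, M z, N (M z), … from an N-free vertex z of a part: flipping
-- its prefixes shows that every second vertex lies in D of that part, so the walk never
-- leaves the part (edges between parts start in A ∪ C) and never reaches another N-free
-- vertex (that would augment N).  Hence the M-walk ends at an M-free, N-covered vertex,
-- which injects the M-covered vertices into the N-covered ones, and N is maximum in G.
-- The π-walk from an N-free vertex of G_i cannot stop, so it closes an N-blossom; that is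
-- the unique odd cycle C_i, whose base then determines the starting vertex.  So each G_i has
-- exactly one N-free vertex, and def G = def B + k.

module Submission where

open import Defs renaming (sym to adj-sym)
open import Data.Bool using (Bool; true; false; not; _∧_)
open import Data.Bool.Properties using (T-≡; T-not-≡; ∧-zeroʳ; ∧-identityʳ)
open import Data.Nat using (ℕ; zero; suc; _+_; _*_; _∸_; _%_; _≤_; _<_; _<ᵇ_; z≤n; s≤s; s≤s⁻¹)
open import Data.Nat.DivMod using ([m+kn]%n≡m%n; m<n⇒m%n≡m; n%n≡0)
open import Data.Nat.Properties hiding (suc-injective) renaming (_≟_ to _≟ℕ_)
open import Data.Fin using (Fin; zero; suc; toℕ; fromℕ; fromℕ<; punchIn; punchOut; _≟_)
open import Data.Fin.Properties
  using (toℕ-injective; suc-injective; toℕ<n; toℕ-fromℕ<; pigeonhole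
        ; punchIn-injective; punchInᵢ≢i; punchIn-punchOut)
open import Data.Integer using (ℤ; +_) renaming (_+_ to _+ℤ_; _*_ to _*ℤ_)
import Data.Integer.Properties as ℤ
open import Data.Maybe using (Maybe; just; nothing; is-just; fromMaybe; _>>=_)
open import Data.Maybe.Properties using (just-injective)
open import Data.Product using (Σ; ∃; _×_; _,_; proj₁; proj₂)
open import Data.Sum using (inj₁; inj₂)
open import Function using (_∘_)
open import Function.Bundles using (Equivalence)
open import Relation.Nullary using (¬_; yes; no; contradiction)
open import Relation.Nullary.Decidable using (⌊_⌋; toWitness; toWitnessFalse)
open import Relation.Binary.PropositionalEquality
open import Relation.Binary.Definitions using (tri<; tri≈; tri>)

-- Counting

count-cong : ∀ {n} {f g : Fin n → Bool} → (∀ i → f i ≡ g i) → count f ≡ count g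
count-cong {zero}  f≗g = refl
count-cong {suc n} f≗g rewrite f≗g zero = cong₂ _+_ refl (count-cong (f≗g ∘ suc))

count-true : ∀ n → count {n} (λ _ → true) ≡ n
count-true zero    = refl
count-true (suc n) = cong suc (count-true n)

count-split : ∀ {n} (f g : Fin n → Bool) →
  count f ≡ count (λ i → f i ∧ g i) + count (λ i → f i ∧ not (g i))
count-split {zero}  f g = refl
count-split {suc n} f g with f zero | g zero
... | false | _     = count-split (f ∘ suc) (g ∘ suc)
... | true  | true  = cong suc (count-split (f ∘ suc) (g ∘ suc))
... | true  | false = trans (cong suc (count-split (f ∘ suc) (g ∘ suc))) (sym (+-suc _ _))

count-insert : ∀ {n} {f g : Fin n → Bool} (p : Fin n) → f p ≡ false → g p ≡ true →
  (∀ i → i ≢ p → f i ≡ g i) → count g ≡ suc (count f)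
count-insert {suc n} {f} {g} zero fp gp f≗g rewrite fp | gp =
  cong suc (sym (count-cong λ i → f≗g (suc i) λ ()))
count-insert {suc n} {f} {g} (suc p) fp gp f≗g rewrite f≗g zero (λ ()) =
  trans (cong₂ _+_ refl (count-insert p fp gp λ i i≢p → f≗g (suc i) (i≢p ∘ suc-injective)))
        (+-suc _ _)

_∖_ : ∀ {n} → (Fin n → Bool) → Fin n → Fin n → Bool
(f ∖ p) i = f i ∧ not ⌊ i ≟ p ⌋

∖-self : ∀ {n} (f : Fin n → Bool) p → (f ∖ p) p ≡ false
∖-self f p with p ≟ p
... | yes _   = ∧-zeroʳ (f p)
... | no p≢p = contradiction refl p≢p

∖-other : ∀ {n} (f : Fin n → Bool) {p i} → i ≢ p → (f ∖ p) i ≡ f i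
∖-other f {p} {i} i≢p with i ≟ p
... | yes i≡p = contradiction i≡p i≢p
... | no _    = ∧-identityʳ (f i)

count-remove : ∀ {n} (f : Fin n → Bool) {p} → f p ≡ true → count f ≡ suc (count (f ∖ p))
count-remove f {p} fp = count-insert p (∖-self f p) fp (λ i → ∖-other f)

count-exchange : ∀ {n} {f g : Fin n → Bool} {p q} → p ≢ q →
  f p ≡ true → g p ≡ false → f q ≡ false → g q ≡ true →
  (∀ i → i ≢ p → i ≢ q → f i ≡ g i) → count f ≡ count g
count-exchange {f = f} {g} {p} {q} p≢q fp gp fq gq f≗g =
  trans (count-remove f fp) (sym (count-insert q (trans (∖-other f (p≢q ∘ sym)) fq) gq agree))
  where
  agree : ∀ i → i ≢ q → (f ∖ p) i ≡ g i
  agree i i≢q with i ≟ p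
  ... | yes refl = trans (∧-zeroʳ (f i)) (sym gp)
  ... | no i≢p   = trans (∧-identityʳ (f i)) (f≗g i i≢p i≢q)

count-insert₂ : ∀ {n} {f g : Fin n → Bool} {p q} → p ≢ q →
  f p ≡ false → g p ≡ true → f q ≡ false → g q ≡ true →
  (∀ i → i ≢ p → i ≢ q → f i ≡ g i) → count g ≡ suc (suc (count f))
count-insert₂ {f = f} {g} {p} {q} p≢q fp gp fq gq f≗g =
  trans (count-remove g gp) (cong suc (count-insert q fq (trans (∖-other g (p≢q ∘ sym)) gq) agree))
  where
  agree : ∀ i → i ≢ q → f i ≡ (g ∖ p) i
  agree i i≢q with i ≟ p
  ... | yes refl = trans fp (sym (∧-zeroʳ (g i)))
  ... | no i≢p   = trans (f≗g i i≢p i≢q) (sym (∧-identityʳ (g i)))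

count-≤-injection : ∀ {m n} (f : Fin m → Bool) (g : Fin n → Bool)
  (h : ∀ i → f i ≡ true → Fin n) →
  (∀ i fi → g (h i fi) ≡ true) →
  (∀ i j fi fj → h i fi ≡ h j fj → i ≡ j) →
  count f ≤ count g
count-≤-injection {zero}  f g h h∈g h-inj = z≤n
count-≤-injection {suc m} f g h h∈g h-inj with f zero in f0
... | false = count-≤-injection (f ∘ suc) g (h ∘ suc) (h∈g ∘ suc)
                (λ i j fi fj e → suc-injective (h-inj (suc i) (suc j) fi fj e))
... | true = ≤-trans (s≤s rest) (≤-reflexive (sym (count-remove g (h∈g zero f0))))
  where
  rest : count (f ∘ suc) ≤ count (g ∖ h zero f0)
  rest = count-≤-injection (f ∘ suc) (g ∖ h zero f0) (h ∘ suc)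
    (λ i fi → trans (∖-other g (h-fresh i fi)) (h∈g (suc i) fi))
    (λ i j fi fj e → suc-injective (h-inj (suc i) (suc j) fi fj e))
    where
    h-fresh : ∀ i fi → h (suc i) fi ≢ h zero f0
    h-fresh i fi e with () ← h-inj (suc i) zero fi f0 e

count-involution : ∀ {n} (f : Fin n → Bool) (ρ : Fin n → Fin n) →
  (∀ i → ρ (ρ i) ≡ i) → count (f ∘ ρ) ≡ count f
count-involution f ρ ρρ = ≤-antisym
  (count-≤-injection (f ∘ ρ) f (λ i _ → ρ i) (λ i fρi → fρi) (λ i j _ _ → ρ-injective i j))
  (count-≤-injection f (f ∘ ρ) (λ i _ → ρ i) (λ i fi → trans (cong f (ρρ i)) fi)
    (λ i j _ _ → ρ-injective i j))
  where
  ρ-injective : ∀ i j → ρ i ≡ ρ j → i ≡ j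
  ρ-injective i j e = trans (sym (ρρ i)) (trans (cong ρ e) (ρρ j))

-- Matchings

covered : ∀ {n} → Matching n → Fin n → Bool
covered M v = is-just (M v)

#covered : ∀ {n} → Matching n → ℕ
#covered M = count (covered M)

<ᵇ-flip : ∀ x y → x ≢ y → (x <ᵇ y) ≡ not (y <ᵇ x)
<ᵇ-flip zero    zero    x≢y = contradiction refl x≢y
<ᵇ-flip zero    (suc y) _   = refl
<ᵇ-flip (suc x) zero    _   = refl
<ᵇ-flip (suc x) (suc y) x≢y = <ᵇ-flip x y (x≢y ∘ cong suc)

module MatchingProperties {n} (G : Graph n) {S : VSet n} {M : Matching n} (M-matching : IsMatching G S M) where

  match-adj : ∀ {u v} → M u ≡ just v → adj G u v ≡ true
  match-adj {u} {v} e = proj₁ (M-matching u v e)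

  match-inˡ : ∀ {u v} → M u ≡ just v → S u ≡ true
  match-inˡ {u} {v} e = proj₁ (proj₂ (M-matching u v e))

  match-inʳ : ∀ {u v} → M u ≡ just v → S v ≡ true
  match-inʳ {u} {v} e = proj₁ (proj₂ (proj₂ (M-matching u v e)))

  match-sym : ∀ {u v} → M u ≡ just v → M v ≡ just u
  match-sym {u} {v} e = proj₂ (proj₂ (proj₂ (M-matching u v e)))

  match-injective : ∀ {u u′ v} → M u ≡ just v → M u′ ≡ just v → u ≡ u′
  match-injective e e′ = just-injective (trans (sym (match-sym e)) (match-sym e′))

  match-irreflexive : ∀ {v} → M v ≢ just v
  match-irreflexive {v} e with () ← trans (sym (match-adj e)) (irrefl G v)


  private
    highEnd : Fin n → Bool
    highEnd v = covered M v ∧ not (lowEnd M v)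

    partner : Fin n → Fin n
    partner v with M v
    ... | just u  = u
    ... | nothing = v

    partner-involutive : ∀ v → partner (partner v) ≡ v
    partner-involutive v with M v in e
    ... | nothing rewrite e = refl
    ... | just u rewrite match-sym e = refl

    highEnd-partner : ∀ v → highEnd (partner v) ≡ lowEnd M v
    highEnd-partner v with M v in e
    ... | nothing rewrite e = refl
    ... | just u rewrite match-sym e =
      sym (<ᵇ-flip (toℕ v) (toℕ u) λ v≡u → match-irreflexive
             (trans e (cong just (sym (toℕ-injective v≡u)))))

  2*msize≡#covered : 2 * msize M ≡ #covered M
  2*msize≡#covered = sym (begin
    #covered M
      ≡⟨ count-split (covered M) (lowEnd M) ⟩
    count (λ v → covered M v ∧ lowEnd M v) + count highEnd
      ≡⟨ cong₂ _+_ (count-cong low-covered) low≡high ⟩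
    msize M + msize M
      ≡⟨ cong (λ m → msize M + m) (sym (+-identityʳ (msize M))) ⟩
    2 * msize M
      ∎)
    where
    open ≡-Reasoning
    low-covered : ∀ v → covered M v ∧ lowEnd M v ≡ lowEnd M v
    low-covered v with M v
    ... | just _  = refl
    ... | nothing = refl
    low≡high : count highEnd ≡ msize M
    low≡high = trans (sym (count-involution highEnd partner partner-involutive))
                     (count-cong highEnd-partner)

  deficiency≡#uncovered : deficiency S M ≡ count (λ v → S v ∧ not (covered M v))
  deficiency≡#uncovered = begin
    count S ∸ 2 * msize M
      ≡⟨ cong₂ _∸_ (count-split S (covered M)) 2*msize≡#covered ⟩
    (count (λ v → S v ∧ covered M v) + #uncovered) ∸ #covered M
      ≡⟨ cong (λ m → (m + #uncovered) ∸ #covered M) (count-cong covered-in-S) ⟩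
    (#covered M + #uncovered) ∸ #covered M
      ≡⟨ m+n∸m≡n (#covered M) #uncovered ⟩
    #uncovered
      ∎
    where
    open ≡-Reasoning
    #uncovered : ℕ
    #uncovered = count (λ v → S v ∧ not (covered M v))
    covered-in-S : ∀ v → S v ∧ covered M v ≡ covered M v
    covered-in-S v with M v in e
    ... | just _  rewrite match-inˡ e = refl
    ... | nothing = ∧-zeroʳ (S v)

-- d 0, a 0, d 1, …, d t, a t is an N-alternating path from an N-free vertex; exchanging it
-- augments N if a t is free, and otherwise moves the free vertex to the N-partner of a t.

module AlternatingPathFlip {n} (G : Graph n) {S : VSet n} {N : Matching n}
  (N-matching : IsMatching G S N) (t : ℕ) (d a : ℕ → Fin n)
  (d-free      : N (d 0) ≡ nothing)
  (da-adj      : ∀ {l} → l ≤ t → adj G (d l) (a l) ≡ true)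
  (ad-matched  : ∀ {l} → l < t → N (a l) ≡ just (d (suc l)))
  (d-injective : ∀ {i j} → i ≤ t → j ≤ t → d i ≡ d j → i ≡ j)
  (a-injective : ∀ {i j} → i ≤ t → j ≤ t → a i ≡ a j → i ≡ j)
  (a≢d         : ∀ {i j} → i ≤ t → j ≤ t → a i ≢ d j)
  (d-in        : ∀ {l} → l ≤ t → S (d l) ≡ true)
  (a-in        : ∀ {l} → l ≤ t → S (a l) ≡ true) where

  open MatchingProperties G N-matching

  private
    index : (ℕ → Fin n) → Fin n → Maybe ℕ
    index f v with anyUpTo? (λ l → f l ≟ v) (suc t)
    ... | yes (l , _ , _) = just l
    ... | no _            = nothing

    index-just : ∀ f {v l} → index f v ≡ just l → l ≤ t × f l ≡ v
    index-just f {v} e with anyUpTo? (λ l → f l ≟ v) (suc t)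
    index-just f {v} refl | yes (l , l≤t , fl≡v) = s≤s⁻¹ l≤t , fl≡v

    index-nothing : ∀ f {v l} → index f v ≡ nothing → l ≤ t → f l ≢ v
    index-nothing f {v} {l} e l≤t fl≡v with anyUpTo? (λ l → f l ≟ v) (suc t)
    index-nothing f {v} {l} () l≤t fl≡v | yes _
    index-nothing f {v} {l} e  l≤t fl≡v | no ∄l = ∄l (l , s≤s l≤t , fl≡v)

    index-of : ∀ f → (∀ {i j} → i ≤ t → j ≤ t → f i ≡ f j → i ≡ j) →
      ∀ {l} → l ≤ t → index f (f l) ≡ just l
    index-of f f-injective {l} l≤t with index f (f l) in e
    ... | just l′ = let l′≤t , fl′≡fl = index-just f e in cong just (f-injective l′≤t l≤t fl′≡fl)
    ... | nothing = contradiction refl (index-nothing f e l≤t)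

    unmatch : Fin n → Maybe (Fin n) → Maybe (Fin n)
    unmatch x nothing = nothing
    unmatch x (just u) with u ≟ x
    ... | yes _ = nothing
    ... | no _  = just u

    unmatch-just : ∀ {x m u} → unmatch x m ≡ just u → m ≡ just u × u ≢ x
    unmatch-just {x} {just u} e with u ≟ x
    unmatch-just {x} {just u} refl | no u≢x = refl , u≢x

    unmatch-other : ∀ {x m} → m ≢ just x → unmatch x m ≡ m
    unmatch-other {x} {nothing} _ = refl
    unmatch-other {x} {just u} m≢x with u ≟ x
    ... | yes refl = contradiction refl m≢x
    ... | no _     = refl

  flip : Matching n
  flip v with index d v | index a v
  ... | just l  | _       = just (a l)
  ... | nothing | just l  = just (d l)
  ... | nothing | nothing = unmatch (a t) (N v)

  flip-d : ∀ {l} → l ≤ t → flip (d l) ≡ just (a l)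
  flip-d l≤t rewrite index-of d d-injective l≤t = refl

  flip-a : ∀ {l} → l ≤ t → flip (a l) ≡ just (d l)
  flip-a {l} l≤t with index d (a l) in e
  ... | just j  = contradiction (proj₂ (index-just d e)) (≢-sym (a≢d l≤t (proj₁ (index-just d e))))
  ... | nothing rewrite index-of a a-injective l≤t = refl

  flip-off : ∀ {v} → index d v ≡ nothing → index a v ≡ nothing → flip v ≡ unmatch (a t) (N v)
  flip-off e e′ rewrite e | e′ = refl

  private
    matched-d : ∀ {l} → suc l ≤ t → N (d (suc l)) ≡ just (a l)
    matched-d l<t = match-sym (ad-matched l<t)

    d-partner : ∀ {l x} → l ≤ t → N (d l) ≡ just x → ∃ λ l′ → suc l′ ≤ t × x ≡ a l′
    d-partner {zero}   _   Nd≡x with () ← trans (sym d-free) Nd≡x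
    d-partner {suc l′} l≤t Nd≡x = l′ , l≤t , just-injective (trans (sym Nd≡x) (matched-d l≤t))

    not-d : ∀ {x y} → N x ≡ just y → index a y ≡ nothing → index d x ≡ nothing
    not-d {x} Nx≡y y-not-a with index d x in e
    ... | nothing = refl
    ... | just l with index-just d e
    ...   | l≤t , refl with l′ , l′<t , y≡aₗ′ ← d-partner l≤t Nx≡y =
      contradiction (sym y≡aₗ′) (index-nothing a y-not-a (<⇒≤ l′<t))

  flip-matching : IsMatching G S flip
  flip-matching v u e with index d v in ed | index a v in ea
  flip-matching v u refl | just l | _ with index-just d ed
  ... | l≤t , refl = da-adj l≤t , d-in l≤t , a-in l≤t , flip-a l≤t
  flip-matching v u refl | nothing | just l with index-just a ea
  ... | l≤t , refl = trans (adj-sym G _ _) (da-adj l≤t) , a-in l≤t , d-in l≤t , flip-d l≤t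
  flip-matching v u e | nothing | nothing with unmatch-just e
  ... | Nv≡u , u≢at = match-adj Nv≡u , match-inˡ Nv≡u , match-inʳ Nv≡u ,
                      trans (flip-off u-not-d u-not-a)
                            (trans (cong (unmatch (a t)) (match-sym Nv≡u)) (unmatch-other v≢at))
    where
    u-not-d : index d u ≡ nothing
    u-not-d = not-d (match-sym Nv≡u) ea
    u-not-a : index a u ≡ nothing
    u-not-a with index a u in e′
    ... | nothing = refl
    ... | just l with index-just a e′
    ...   | l≤t , refl with l ≟ℕ t
    ...     | yes refl = contradiction refl u≢at
    ...     | no l≢t = contradiction
                           (just-injective (trans (sym (ad-matched (≤∧≢⇒< l≤t l≢t))) (match-sym Nv≡u)))
                                     (index-nothing d ed (≤∧≢⇒< l≤t l≢t))
    v≢at : just v ≢ just (a t)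
    v≢at e′ = index-nothing a ea ≤-refl (sym (just-injective e′))

  private
    open MatchingProperties G flip-matching using ()
      renaming (2*msize≡#covered to 2*msize-flip≡#covered)

    covered-elsewhere : ∀ {v} → v ≢ d 0 → v ≢ a t → N v ≢ just (a t) → covered flip v ≡ covered N v
    covered-elsewhere {v} v≢d0 v≢at Nv≢at with index d v in ed | index a v in ea
    ... | just zero    | _ = contradiction (sym (proj₂ (index-just d ed))) v≢d0
    ... | just (suc l) | _ with index-just d ed
    ...   | l<t , refl rewrite matched-d l<t = refl
    covered-elsewhere {v} v≢d0 v≢at Nv≢at | nothing | just l with index-just a ea
    ...   | l≤t , refl with l ≟ℕ t
    ...     | yes refl = contradiction refl v≢at
    ...     | no l≢t rewrite ad-matched (≤∧≢⇒< l≤t l≢t) = refl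
    covered-elsewhere {v} v≢d0 v≢at Nv≢at | nothing | nothing = cong is-just (unmatch-other Nv≢at)

  augmenting-path : N (a t) ≡ nothing → ¬ IsMaxMatching G S N
  augmenting-path at-free (_ , N-maximum) =
    1+n≰n (≤-trans (≤-reflexive (sym flip-larger)) (N-maximum flip flip-matching))
    where
    open ≡-Reasoning
    covered-gain : #covered flip ≡ suc (suc (#covered N))
    covered-gain = count-insert₂ (≢-sym (a≢d ≤-refl z≤n))
      (cong is-just d-free) (cong is-just (flip-d z≤n)) (cong is-just at-free) (cong is-just (flip-a ≤-refl))
      (λ v v≢d0 v≢at → sym (covered-elsewhere v≢d0 v≢at λ Nv≡at →
         contradiction (trans (sym at-free) (match-sym Nv≡at)) λ ()))
    flip-larger : msize flip ≡ suc (msize N)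
    flip-larger = *-cancelˡ-≡ _ _ 2 (begin
      2 * msize flip           ≡⟨ 2*msize-flip≡#covered ⟩
      #covered flip            ≡⟨ covered-gain ⟩
      suc (suc (#covered N))   ≡⟨ cong (λ m → suc (suc m)) (sym 2*msize≡#covered) ⟩
      2 + 2 * msize N          ≡⟨ sym (*-suc 2 (msize N)) ⟩
      2 * suc (msize N)        ∎)

  private
    module Exchange {w} (at≡w : N (a t) ≡ just w) where

      w-not-d : index d w ≡ nothing
      w-not-d with index d w in e
      ... | nothing = refl
      ... | just l with index-just d e
      ...   | l≤t , refl with l′ , l′<t , at≡aₗ′ ← d-partner l≤t (match-sym at≡w) =
        contradiction (a-injective ≤-refl (<⇒≤ l′<t) at≡aₗ′) (>⇒≢ l′<t)

      w-not-a : index a w ≡ nothing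
      w-not-a with index a w in e
      ... | nothing = refl
      ... | just l with index-just a e
      ...   | l≤t , refl with l ≟ℕ t
      ...     | yes refl = contradiction at≡w match-irreflexive
      ...     | no l≢t   = contradiction
        (just-injective (trans (sym (match-sym at≡w)) (ad-matched (≤∧≢⇒< l≤t l≢t))))
        (a≢d ≤-refl (≤∧≢⇒< l≤t l≢t))

      flip-w : flip w ≡ nothing
      flip-w = trans (flip-off w-not-d w-not-a) (trans (cong (unmatch (a t)) (match-sym at≡w)) unmatch-self)
        where
        unmatch-self : unmatch (a t) (just (a t)) ≡ nothing
        unmatch-self with a t ≟ a t
        ... | yes _     = refl
        ... | no at≢at = contradiction refl at≢at

      agree : ∀ v → v ≢ d 0 → v ≢ w → covered flip v ≡ covered N v
      agree v v≢d0 v≢w with v ≟ a t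
      ... | yes refl = trans (cong is-just (flip-a ≤-refl)) (sym (cong is-just at≡w))
      ... | no v≢at  = covered-elsewhere v≢d0 v≢at λ Nv≡at →
                         v≢w (just-injective (trans (sym (match-sym Nv≡at)) at≡w))

      same-size : msize flip ≡ msize N
      same-size = *-cancelˡ-≡ _ _ 2 (begin
        2 * msize flip   ≡⟨ 2*msize-flip≡#covered ⟩
        #covered flip    ≡⟨ count-exchange (index-nothing d w-not-d z≤n) (cong is-just (flip-d z≤n))
                              (cong is-just d-free) (cong is-just flip-w) (cong is-just (match-sym at≡w)) agree ⟩
        #covered N       ≡⟨ sym 2*msize≡#covered ⟩
        2 * msize N      ∎)
        where open ≡-Reasoning

  path-end-in-D : IsMaxMatching G S N → ∀ {w} → N (a t) ≡ just w → InD G S w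
  path-end-in-D (_ , N-maximum) at≡w = match-inʳ at≡w , flip , (flip-matching , flip-maximum) , flip-w
    where
    open Exchange at≡w
    flip-maximum : ∀ M′ → IsMatching G S M′ → msize M′ ≤ msize flip
    flip-maximum M′ M′-matching = ≤-trans (N-maximum M′ M′-matching) (≤-reflexive (sym same-size))

-- Odd cycles and blossoms

data Parity (r : ℕ) : Set where
  even : ∀ l → r ≡ l + l → Parity r
  odd  : ∀ l → r ≡ suc (l + l) → Parity r

parity : ∀ r → Parity r
parity zero = even 0 refl
parity (suc r) with parity r
... | even l r≡2l = odd l (cong suc r≡2l)
... | odd l r≡2l+1 = even (suc l) (cong suc (trans r≡2l+1 (sym (+-suc l l))))

half-≤ : ∀ l {K} → l + l ≤ K + K → l ≤ K
half-≤ l {K} 2l≤2K with <-cmp l K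
... | tri< l<K _ _ = <⇒≤ l<K
... | tri≈ _ refl _ = ≤-refl
... | tri> _ _ K<l = contradiction 2l≤2K (<⇒≱ (+-mono-< K<l K<l))

half-< : ∀ l {K} → suc (l + l) ≤ K + K → l < K
half-< l {K} 2l<2K with <-cmp l K
... | tri< l<K _ _ = l<K
... | tri≈ _ refl _ = contradiction 2l<2K 1+n≰n
... | tri> _ _ K<l = contradiction (<⇒≤ 2l<2K) (<⇒≱ (+-mono-< K<l K<l))

odd-%2 : ∀ K → suc (K + K) % 2 ≡ 1
odd-%2 K = trans (cong (λ m → suc m % 2) (trans (cong (λ m → K + m) (sym (+-identityʳ K))) (*-comm 2 K)))
                 ([m+kn]%n≡m%n 1 K 2)

interleave : ∀ {A : Set} → (ℕ → A) → (ℕ → A) → ℕ → A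
interleave f g zero    = f 0
interleave f g (suc r) = interleave g (f ∘ suc) r

interleave-even : ∀ {A : Set} l (f g : ℕ → A) → interleave f g (l + l) ≡ f l
interleave-even zero    f g = refl
interleave-even (suc l) f g =
  trans (cong (interleave g (f ∘ suc)) (+-suc l l)) (interleave-even l (f ∘ suc) (g ∘ suc))

interleave-odd : ∀ {A : Set} l (f g : ℕ → A) → interleave f g (suc (l + l)) ≡ g l
interleave-odd l f g = interleave-even l g (f ∘ suc)

next-< : ∀ {m} (i : Fin (suc m)) → toℕ i < m → toℕ (next i) ≡ suc (toℕ i)
next-< {m} i i<m = trans (toℕ-fromℕ< _) (m<n⇒m%n≡m (s≤s i<m))

next-last : ∀ {m} (i : Fin (suc m)) → toℕ i ≡ m → toℕ (next i) ≡ 0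
next-last {m} i i≡m = trans (toℕ-fromℕ< _) (trans (cong (λ r → suc r % suc m) i≡m) (n%n≡0 (suc m)))

module _ {n} {G : Graph n} {S : VSet n} where

  edge-onˡ : (C : Cycle G S) → ∀ {u v} → CycEdge C u v → OnCycle C u
  edge-onˡ C (i , inj₁ (vᵢ≡u , _)) = i , vᵢ≡u
  edge-onˡ C (i , inj₂ (_ , vᵢ₊₁≡u)) = next i , vᵢ₊₁≡u

  edge-onʳ : (C : Cycle G S) → ∀ {u v} → CycEdge C u v → OnCycle C v
  edge-onʳ C (i , inj₁ (_ , vᵢ₊₁≡v)) = next i , vᵢ₊₁≡v
  edge-onʳ C (i , inj₂ (vᵢ≡v , _)) = i , vᵢ≡v

  -- An N-blossom whose base is vtx C zero, described through the cycle's edges.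
  record BasedBlossom (N : Matching n) (C : Cycle G S) : Set where
    field
      matched-along  : ∀ i → i ≢ zero → ∃ λ u → N (vtx C i) ≡ just u × CycEdge C (vtx C i) u
      base-unmatched : ∀ {u} → N (vtx C zero) ≡ just u → ¬ CycEdge C (vtx C zero) u

  blossom-base-unique : ∀ {N} (C C′ : Cycle G S) →
    (∀ {u v} → CycEdge C u v → CycEdge C′ u v) → (∀ {u v} → CycEdge C′ u v → CycEdge C u v) →
    BasedBlossom N C → BasedBlossom N C′ → vtx C zero ≡ vtx C′ zero
  blossom-base-unique {N} C C′ C⊆C′ C′⊆C B B′ with edge-onˡ C (C′⊆C (zero , inj₁ (refl , refl)))
  ... | zero  , v₀≡v′₀ = v₀≡v′₀
  ... | suc i , vᵢ≡v′₀ with BasedBlossom.matched-along B (suc i) (λ ())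
  ...   | u , Nvᵢ≡u , edge = contradiction
    (C⊆C′ (subst (λ x → CycEdge C x u) vᵢ≡v′₀ edge))
    (BasedBlossom.base-unmatched B′ (subst (λ x → N x ≡ just u) vᵢ≡v′₀ Nvᵢ≡u))

-- The walk z = d z 0, a z 0, d z 1, a z 1, … alternates σ-steps and N-steps; d z l and a z l
-- default to z where it is undefined.

module AlternatingWalk {n} (G : Graph n) {S : VSet n} {N : Matching n}
  (N-maximum : IsMaxMatching G S N)
  (σ : Fin n → Maybe (Fin n))
  (σ-adj       : ∀ {u v} → σ u ≡ just v → adj G u v ≡ true)
  (σ-injective : ∀ {u u′ v} → σ u ≡ just v → σ u′ ≡ just v → u ≡ u′)
  (σ-closed    : ∀ {u v} → InD G S u → σ u ≡ just v → S v ≡ true) where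

  N-matching : IsMatching G S N
  N-matching = proj₁ N-maximum

  open MatchingProperties G N-matching

  step : Fin n → Maybe (Fin n)
  step v = σ v >>= N

  walk : Fin n → ℕ → Maybe (Fin n)
  walk z zero    = just z
  walk z (suc l) = walk z l >>= step

  d : Fin n → ℕ → Fin n
  d z l = fromMaybe z (walk z l)

  a : Fin n → ℕ → Fin n
  a z l = fromMaybe z (σ (d z l))

  record Reaches (z : Fin n) (t : ℕ) : Set where
    constructor reaching
    field walk-defined : walk z t ≡ just (d z t)
  open Reaches

  reaches : ∀ {z t v} → walk z t ≡ just v → Reaches z t
  reaches {z} {t} e = reaching (trans e (cong (just ∘ fromMaybe z) (sym e)))

  walk-step : ∀ {z l v} → walk z (suc l) ≡ just v →
    Reaches z l × σ (d z l) ≡ just (a z l) × N (a z l) ≡ just v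
  walk-step {z} {l} e with walk z l in wl
  ... | nothing with () ← e
  ... | just u with σ u
  ...   | nothing with () ← e
  ...   | just x = reaches wl , refl , e

  walk-suc : ∀ {z t x y} → Reaches z t → σ (d z t) ≡ just x → N x ≡ just y → walk z (suc t) ≡ just y
  walk-suc (reaching r) σx Nx rewrite r | σx | Nx = refl

  a-of : ∀ {z t x} → σ (d z t) ≡ just x → a z t ≡ x
  a-of σx rewrite σx = refl

  reaches-≤ : ∀ {z t l} → Reaches z t → l ≤ t → Reaches z l
  reaches-≤ {t = t} {l} r l≤t with l ≟ℕ t
  ... | yes refl = r
  reaches-≤ {t = zero}  r l≤t | no l≢t = contradiction (n≤0⇒n≡0 l≤t) l≢t
  reaches-≤ {z} {suc t} r l≤t | no l≢t =
    reaches-≤ (proj₁ (walk-step {z} {t} (walk-defined r))) (s≤s⁻¹ (≤∧≢⇒< l≤t l≢t))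

  σ-step : ∀ {z t l} → Reaches z t → l < t → σ (d z l) ≡ just (a z l)
  σ-step {z} {l = l} r l<t = proj₁ (proj₂ (walk-step {z} {l} (walk-defined (reaches-≤ r l<t))))

  N-step : ∀ {z t l} → Reaches z t → l < t → N (a z l) ≡ just (d z (suc l))
  N-step {z} {l = l} r l<t = proj₂ (proj₂ (walk-step {z} {l} (walk-defined (reaches-≤ r l<t))))

  walk-backward-unique : ∀ {z z′} i j {v} → N z ≡ nothing → N z′ ≡ nothing →
    walk z i ≡ just v → walk z′ j ≡ just v → z ≡ z′ × i ≡ j
  walk-backward-unique zero    zero    _ _ refl refl = refl , refl
  walk-backward-unique {z} {z′} zero (suc j) z-free _ refl e′
    with () ← trans (sym z-free) (match-sym (proj₂ (proj₂ (walk-step {z′} {j} e′))))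
  walk-backward-unique {z} {z′} (suc i) zero _ z′-free e refl
    with () ← trans (sym z′-free) (match-sym (proj₂ (proj₂ (walk-step {z} {i} e))))
  walk-backward-unique {z} {z′} (suc i) (suc j) z-free z′-free e e′
    with reaching r , σ-i , N-i ← walk-step {z} {i} e | reaching r′ , σ-j , N-j ← walk-step {z′} {j} e′ =
    let a≡a′ = match-injective N-i N-j
        d≡d′ = σ-injective σ-i (trans σ-j (cong just (sym a≡a′)))
        z≡z′ , i≡j = walk-backward-unique i j z-free z′-free r (trans r′ (cong just (sym d≡d′)))
    in z≡z′ , cong suc i≡j

  d-injective : ∀ {z t i j} → N z ≡ nothing → Reaches z t → i ≤ t → j ≤ t → d z i ≡ d z j → i ≡ j
  d-injective {i = i} {j} z-free r i≤t j≤t e = proj₂ (walk-backward-unique i j z-free z-free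
    (trans (walk-defined (reaches-≤ r i≤t)) (cong just e)) (walk-defined (reaches-≤ r j≤t)))

  d-partner : ∀ {z t s u} → N z ≡ nothing → Reaches z t → s ≤ t → N (d z s) ≡ just u →
    ∃ λ s′ → s ≡ suc s′ × u ≡ a z s′
  d-partner {s = zero}   z-free r _ Nz≡u with () ← trans (sym z-free) Nz≡u
  d-partner {s = suc s′} z-free r s≤t Nds≡u =
    s′ , refl , just-injective (trans (sym Nds≡u) (match-sym (N-step r s≤t)))

  a-injective : ∀ {z t i j} → N z ≡ nothing → Reaches z t → i < t → j < t → a z i ≡ a z j → i ≡ j
  a-injective z-free r i<t j<t e = d-injective z-free r (<⇒≤ i<t) (<⇒≤ j<t)
    (σ-injective (trans (σ-step r i<t) (cong just e)) (σ-step r j<t))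

  -- in-D holds because flipping the path up to d z l leaves d z l uncovered (path-end-in-D).
  record Explored (z : Fin n) (t : ℕ) : Set where
    field
      reached   : Reaches z t
      no-return : ∀ {i j} → i < t → j ≤ i → a z i ≢ d z j
      in-D      : ∀ {l} → l ≤ t → InD G S (d z l)

    a≢d : ∀ {i j} → i < t → j ≤ t → a z i ≢ d z j
    a≢d {i} {zero}  i<t _   = no-return i<t z≤n
    a≢d {i} {suc j} i<t j<t with <-cmp j i
    ... | tri< j<i _ _ = no-return i<t j<i
    ... | tri≈ _ refl _ = λ e → match-irreflexive (trans (N-step reached i<t) (cong just (sym e)))
    ... | tri> _ _ i<j = λ e → no-return j<t i<j (just-injective
            (trans (sym (match-sym (N-step reached j<t))) (trans (cong N (sym e)) (N-step reached i<t))))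

  open Explored

  data Outcome (z : Fin n) : Set where
    stops   : ∀ t → Explored z t → σ (d z t) ≡ nothing → Outcome z
    returns : ∀ t s → Explored z t → s ≤ t → σ (d z t) ≡ just (d z s) → Outcome z

  explored-0 : ∀ {z} → S z ≡ true → N z ≡ nothing → Explored z 0
  explored-0 z-in z-free = record
    { reached   = reaching refl
    ; no-return = λ ()
    ; in-D      = λ { z≤n → z-in , N , N-maximum , z-free } }

  module Extend {z t x} (ex : Explored z t) (z-free : N z ≡ nothing)
    (σx : σ (d z t) ≡ just x) (fresh : ∀ {l} → l ≤ t → d z l ≢ x) where

    a≡x : a z t ≡ x
    a≡x = a-of {z} {t} σx

    σ-defined : ∀ {l} → l ≤ t → σ (d z l) ≡ just (a z l)
    σ-defined {l} l≤t with l ≟ℕ t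
    ... | yes refl = trans σx (cong just (sym a≡x))
    ... | no l≢t   = σ-step (reached ex) (≤∧≢⇒< l≤t l≢t)

    path-a≢d : ∀ {i j} → i ≤ t → j ≤ t → a z i ≢ d z j
    path-a≢d {i} i≤t j≤t with i ≟ℕ t
    ... | yes refl = λ e → fresh j≤t (trans (sym e) a≡x)
    ... | no i≢t   = a≢d ex (≤∧≢⇒< i≤t i≢t) j≤t

    open AlternatingPathFlip G N-matching t (d z) (a z) z-free
      (λ l≤t → σ-adj (σ-defined l≤t)) (N-step (reached ex)) (d-injective z-free (reached ex))
      (λ i≤t j≤t e → d-injective z-free (reached ex) i≤t j≤t
                       (σ-injective (trans (σ-defined i≤t) (cong just e)) (σ-defined j≤t)))
      path-a≢d (λ l≤t → proj₁ (in-D ex l≤t)) (λ l≤t → σ-closed (in-D ex l≤t) (σ-defined l≤t))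

    x-matched : N x ≢ nothing
    x-matched Nx = augmenting-path (trans (cong N a≡x) Nx) N-maximum

    explored-suc : ∀ {y} → N x ≡ just y → Explored z (suc t)
    explored-suc {y} Nx = record
      { reached   = reached′
      ; no-return = no-return′
      ; in-D      = in-D′ }
      where
      reached′ : Reaches z (suc t)
      reached′ = reaches (walk-suc (reached ex) σx Nx)
      d≡y : d z (suc t) ≡ y
      d≡y = just-injective (trans (sym (walk-defined reached′)) (walk-suc (reached ex) σx Nx))
      no-return′ : ∀ {i j} → i < suc t → j ≤ i → a z i ≢ d z j
      no-return′ {i} i<t′ j≤i with i ≟ℕ t
      ... | yes refl = path-a≢d ≤-refl j≤i
      ... | no i≢t   = no-return ex (≤∧≢⇒< (s≤s⁻¹ i<t′) i≢t) j≤i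
      in-D′ : ∀ {l} → l ≤ suc t → InD G S (d z l)
      in-D′ {l} l≤t′ with l ≟ℕ suc t
      ... | yes refl = subst (InD G S) (sym d≡y) (path-end-in-D N-maximum (trans (cong N a≡x) Nx))
      ... | no l≢t′  = in-D ex (s≤s⁻¹ (≤∧≢⇒< l≤t′ l≢t′))

  private
    -- The vertices d z l are distinct, so the walk stops or returns within n steps.
    run : ∀ {z} → N z ≡ nothing → ∀ fuel t → fuel + t ≡ n → Explored z t → Outcome z
    run {z} z-free zero t refl ex
      with i , j , i<j , dᵢ≡dⱼ ← pigeonhole ≤-refl (λ (i : Fin (suc n)) → d z (toℕ i))
      = contradiction (d-injective z-free (reached ex) (s≤s⁻¹ (toℕ<n i))
                        (s≤s⁻¹ (toℕ<n j)) dᵢ≡dⱼ) (<⇒≢ i<j)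
    run {z} z-free (suc fuel) t fuel+t≡n ex with σ (d z t) in σx
    ... | nothing = stops t ex σx
    ... | just x with anyUpTo? (λ l → d z l ≟ x) (suc t)
    ...   | yes (s , s≤t , ds≡x) = returns t s ex (s≤s⁻¹ s≤t) (trans σx (cong just (sym ds≡x)))
    ...   | no fresh with N x in Nx
    ...     | nothing = contradiction Nx (Extend.x-matched ex z-free σx λ l≤t e → fresh (_ , s≤s l≤t , e))
    ...     | just y  = run z-free fuel (suc t) (trans (+-suc fuel t) fuel+t≡n)
                          (Extend.explored-suc ex z-free σx (λ l≤t e → fresh (_ , s≤s l≤t , e)) Nx)

  classify : ∀ {z} → S z ≡ true → N z ≡ nothing → Outcome z
  classify z-in z-free = run z-free _ 0 (+-identityʳ _) (explored-0 z-in z-free)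

  -- A return σ (d z t) ≡ just (d z s) closes the odd cycle d z s, a z s, d z (s + 1), …, d z t.
  module ReturnCycle {z t s} (z-free : N z ≡ nothing) (ex : Explored z t) (s<t : s < t)
    (σ-return : σ (d z t) ≡ just (d z s)) where

    K : ℕ
    K = t ∸ s

    K+s≡t : K + s ≡ t
    K+s≡t = m∸n+n≡m (<⇒≤ s<t)

    d-bound : ∀ {l} → l ≤ K → l + s ≤ t
    d-bound l≤K = subst (_ ≤_) K+s≡t (+-monoˡ-≤ s l≤K)

    a-bound : ∀ {l} → l < K → l + s < t
    a-bound l<K = subst (_ <_) K+s≡t (+-monoˡ-< s l<K)

    vx : ℕ → Fin n
    vx = interleave (λ l → d z (l + s)) (λ l → a z (l + s))

    vx-d : ∀ {r} l → r ≡ l + l → vx r ≡ d z (l + s)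
    vx-d l refl = interleave-even l (λ l → d z (l + s)) (λ l → a z (l + s))

    vx-a : ∀ {r} l → r ≡ suc (l + l) → vx r ≡ a z (l + s)
    vx-a l refl = interleave-odd l (λ l → d z (l + s)) (λ l → a z (l + s))

    data Position (r : ℕ) : Set where
      at-d : ∀ l → l ≤ K → r ≡ l + l → Position r
      at-a : ∀ l → l < K → r ≡ suc (l + l) → Position r

    position : ∀ {r} → r ≤ K + K → Position r
    position {r} r≤2K with parity r
    ... | even l r≡2l   = at-d l (half-≤ l (subst (_≤ K + K) r≡2l r≤2K)) r≡2l
    ... | odd l r≡2l+1 = at-a l (half-< l (subst (_≤ K + K) r≡2l+1 r≤2K)) r≡2l+1

    vx-injective : ∀ {r₁ r₂} → r₁ ≤ K + K → r₂ ≤ K + K → vx r₁ ≡ vx r₂ → r₁ ≡ r₂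
    vx-injective r₁≤ r₂≤ e with position r₁≤ | position r₂≤
    ... | at-d l₁ l₁≤K refl | at-d l₂ l₂≤K refl =
      let l₁≡l₂ = +-cancelʳ-≡ s l₁ l₂ (d-injective z-free (reached ex) (d-bound l₁≤K) (d-bound l₂≤K)
                    (trans (sym (vx-d l₁ refl)) (trans e (vx-d l₂ refl))))
      in cong₂ _+_ l₁≡l₂ l₁≡l₂
    ... | at-a l₁ l₁<K refl | at-a l₂ l₂<K refl =
      let l₁≡l₂ = +-cancelʳ-≡ s l₁ l₂ (a-injective z-free (reached ex) (a-bound l₁<K) (a-bound l₂<K)
                    (trans (sym (vx-a l₁ refl)) (trans e (vx-a l₂ refl))))
      in cong suc (cong₂ _+_ l₁≡l₂ l₁≡l₂)
    ... | at-d l₁ l₁≤K refl | at-a l₂ l₂<K refl = contradiction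
      (trans (sym (vx-a l₂ refl)) (trans (sym e) (vx-d l₁ refl))) (a≢d ex (a-bound l₂<K) (d-bound l₁≤K))
    ... | at-a l₁ l₁<K refl | at-d l₂ l₂≤K refl = contradiction
      (trans (sym (vx-a l₁ refl)) (trans e (vx-d l₂ refl))) (a≢d ex (a-bound l₁<K) (d-bound l₂≤K))

    vx-in-S : ∀ {r} → r ≤ K + K → S (vx r) ≡ true
    vx-in-S r≤2K with position r≤2K
    ... | at-d l l≤K r≡2l   = subst (λ v → S v ≡ true) (sym (vx-d l r≡2l)) (proj₁ (in-D ex (d-bound l≤K)))
    ... | at-a l l<K r≡2l+1 = subst (λ v → S v ≡ true) (sym (vx-a l r≡2l+1))
                                (σ-closed (in-D ex (<⇒≤ (a-bound l<K))) (σ-step (reached ex) (a-bound l<K)))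

    vx-adj : ∀ r → r < K + K → adj G (vx r) (vx (suc r)) ≡ true
    vx-adj r r<2K with parity r
    ... | even l refl = subst₂ (λ u v → adj G u v ≡ true) (sym (vx-d {l + l} l refl)) (sym (vx-a l refl))
                          (σ-adj (σ-step (reached ex) (a-bound (half-< l r<2K))))
    ... | odd l refl = subst₂ (λ u v → adj G u v ≡ true) (sym (vx-a {suc (l + l)} l refl))
                          (sym (vx-d {suc (suc (l + l))} (suc l) (cong suc (sym (+-suc l l)))))
                          (match-adj (N-step (reached ex) (a-bound (half-< l (<⇒≤ r<2K)))))

    vx-closing-adj : adj G (vx (K + K)) (vx 0) ≡ true
    vx-closing-adj = subst (λ v → adj G v (d z s) ≡ true)
                       (sym (trans (vx-d K refl) (cong (d z) K+s≡t))) (σ-adj σ-return)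

    1≤K : 1 ≤ K
    1≤K = m<n⇒0<n∸m s<t

    toℕ≤2K : (i : Fin (suc (K + K))) → toℕ i ≤ K + K
    toℕ≤2K i = s≤s⁻¹ (toℕ<n i)

    cycle : Cycle G S
    cycle = record
      { m     = K + K
      ; len≥3 = +-mono-≤ 1≤K 1≤K
      ; vtx   = vx ∘ toℕ
      ; inj   = λ {i} {j} e → toℕ-injective (vx-injective (toℕ≤2K i) (toℕ≤2K j) e)
      ; inS   = vx-in-S ∘ toℕ≤2K
      ; adjc  = cycle-adj }
      where
      cycle-adj : ∀ i → adj G (vx (toℕ i)) (vx (toℕ (next i))) ≡ true
      cycle-adj i with m≤n⇒m<n∨m≡n (toℕ≤2K i)
      ... | inj₁ i<2K  = subst (λ r → adj G (vx (toℕ i)) (vx r) ≡ true) (sym (next-< i i<2K)) (vx-adj _ i<2K)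
      ... | inj₂ i≡2K = subst₂ (λ r r′ → adj G (vx r) (vx r′) ≡ true) (sym i≡2K) (sym (next-last i i≡2K))
                            vx-closing-adj

    cycle-odd : OddCycle cycle
    cycle-odd = odd-%2 K

    cycle-matched-along : ∀ i → i ≢ zero → ∃ λ u → N (vtx cycle i) ≡ just u × CycEdge cycle (vtx cycle i) u
    cycle-matched-along i i≢0 with position (toℕ≤2K i)
    ... | at-d zero _ i≡0 = contradiction (toℕ-injective i≡0) i≢0
    ... | at-d (suc l) l<K i≡2l+2 = a z (l + s) , Nvᵢ , j , inj₂ (vⱼ , vⱼ₊₁)
      where
      Nvᵢ : N (vx (toℕ i)) ≡ just (a z (l + s))
      Nvᵢ = trans (cong N (vx-d (suc l) i≡2l+2)) (match-sym (N-step (reached ex) (a-bound l<K)))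
      2l+1<2K : suc (l + l) < K + K
      2l+1<2K = subst (_≤ K + K) (trans i≡2l+2 (cong suc (+-suc l l))) (toℕ≤2K i)
      j : Fin (suc (K + K))
      j = fromℕ< (m<n⇒m<1+n 2l+1<2K)
      j≡2l+1 : toℕ j ≡ suc (l + l)
      j≡2l+1 = toℕ-fromℕ< (m<n⇒m<1+n 2l+1<2K)
      vⱼ : vx (toℕ j) ≡ a z (l + s)
      vⱼ = vx-a l j≡2l+1
      vⱼ₊₁ : vx (toℕ (next j)) ≡ vx (toℕ i)
      vⱼ₊₁ = cong vx (trans (next-< j (subst (_< K + K) (sym j≡2l+1) 2l+1<2K))
                            (trans (cong suc j≡2l+1) (trans (cong suc (sym (+-suc l l))) (sym i≡2l+2))))
    ... | at-a l l<K i≡2l+1 = d z (suc (l + s)) , Nvᵢ , i , inj₁ (refl , vᵢ₊₁)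
      where
      Nvᵢ : N (vx (toℕ i)) ≡ just (d z (suc (l + s)))
      Nvᵢ = trans (cong N (vx-a l i≡2l+1)) (N-step (reached ex) (a-bound l<K))
      i<2K : toℕ i < K + K
      i<2K = subst (_≤ K + K) (cong suc (trans (+-suc l l) (sym i≡2l+1))) (+-mono-≤ l<K l<K)
      vᵢ₊₁ : vx (toℕ (next i)) ≡ d z (suc (l + s))
      vᵢ₊₁ = trans (cong vx (next-< i i<2K)) (vx-d (suc l) (cong suc (trans i≡2l+1 (sym (+-suc l l)))))

    -- The N-partner of the base d z s is a z (s ∸ 1), which precedes the cycle on the walk.
    cycle-base-unmatched : ∀ {u} → N (d z s) ≡ just u → ¬ CycEdge cycle (d z s) u
    cycle-base-unmatched {u} Nds≡u edge with s′ , refl , refl ← d-partner z-free (reached ex) (<⇒≤ s<t) Nds≡u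
      with j , vⱼ≡u ← edge-onʳ cycle edge | position (toℕ≤2K j)
    ... | at-d l l≤K j≡2l   =
      a≢d ex (<-trans (n<1+n s′) s<t) (d-bound l≤K) (trans (sym vⱼ≡u) (vx-d l j≡2l))
    ... | at-a l l<K j≡2l+1 = <⇒≢ (m≤n+m s l) (sym (a-injective z-free (reached ex) (a-bound l<K)
                                (<-trans (n<1+n s′) s<t) (trans (sym (vx-a l j≡2l+1)) vⱼ≡u)))

    cycle-blossom : BasedBlossom N cycle
    cycle-blossom = record { matched-along = cycle-matched-along ; base-unmatched = cycle-base-unmatched }

  σ-irreflexive : ∀ {v} → σ v ≢ just v
  σ-irreflexive {v} σv≡v with () ← trans (sym (σ-adj σv≡v)) (irrefl G v)

  module _ (σ-total : ∀ v → σ v ≢ nothing) where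

    private
      record BlossomFrom (z : Fin n) : Set where
        field
          s            : ℕ
          reach        : Reaches z s
          cycle        : Cycle G S
          cycle-is-odd : OddCycle cycle
          blossom      : BasedBlossom N cycle
          base         : vtx cycle zero ≡ d z s

      blossom-from : ∀ {z} → S z ≡ true → N z ≡ nothing → BlossomFrom z
      blossom-from {z} z-in z-free with classify z-in z-free
      ... | stops t ex σ≡nothing = contradiction σ≡nothing (σ-total _)
      ... | returns t s ex s≤t σ-return with m≤n⇒m<n∨m≡n s≤t
      ...   | inj₂ refl = contradiction σ-return σ-irreflexive
      ...   | inj₁ s<t = record
        { s = s ; reach = reaches-≤ (reached ex) s≤t
        ; cycle = cycle ; cycle-is-odd = cycle-odd ; blossom = cycle-blossom ; base = refl }
        where open ReturnCycle z-free ex s<t σ-return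

    free-vertex-unique : ∀ {C₀} → IsUniqueOddCycle G S C₀ → ∀ {z z′} →
      S z ≡ true → S z′ ≡ true → N z ≡ nothing → N z′ ≡ nothing → z ≡ z′
    free-vertex-unique (_ , unique) {z} {z′} z-in z′-in z-free z′-free =
      proj₁ (walk-backward-unique (s B) (s B′) z-free z′-free
               (walk-defined (reach B)) (trans (walk-defined (reach B′)) (cong just (sym same-base))))
      where
      open BlossomFrom
      B  = blossom-from z-in z-free
      B′ = blossom-from z′-in z′-free
      same-edges : ∀ (C C′ : Cycle G S) → OddCycle C → OddCycle C′ →
        ∀ {u v} → CycEdge C u v → CycEdge C′ u v
      same-edges C C′ odd-C odd-C′ {u} {v} e =
        Equivalence.from (unique C′ odd-C′ u v) (Equivalence.to (unique C odd-C u v) e)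
      same-base : d z (s B) ≡ d z′ (s B′)
      same-base = trans (sym (base B)) (trans
        (blossom-base-unique (cycle B) (cycle B′)
          (same-edges (cycle B) (cycle B′) (cycle-is-odd B) (cycle-is-odd B′))
          (same-edges (cycle B′) (cycle B) (cycle-is-odd B′) (cycle-is-odd B))
          (blossom B) (blossom B′))
        (base B′))

  record MatchedEnd (z : Fin n) : Set where
    field
      length      : ℕ
      end         : Fin n
      walk-end    : walk z length ≡ just end
      end-in      : S end ≡ true
      end-σ-free  : σ end ≡ nothing
      end-matched : N end ≢ nothing

  module _ (σ-sym : ∀ {u v} → σ u ≡ just v → σ v ≡ just u) where

    matched-end : ∀ {z} → S z ≡ true → N z ≡ nothing → σ z ≢ nothing → MatchedEnd z
    matched-end {z} z-in z-free σz≢nothing with classify z-in z-free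
    ... | stops zero ex σz≡nothing = contradiction σz≡nothing σz≢nothing
    ... | stops (suc t) ex σ≡nothing = record
      { length = suc t ; end = d z (suc t) ; walk-end = walk-defined (reached ex)
      ; end-in = proj₁ (in-D ex ≤-refl) ; end-σ-free = σ≡nothing
      ; end-matched = λ N≡nothing → contradiction
          (trans (sym N≡nothing) (match-sym (N-step (reached ex) ≤-refl))) λ () }
    ... | returns t s ex s≤t σ-return with m≤n⇒m<n∨m≡n s≤t
    ...   | inj₂ refl = contradiction σ-return σ-irreflexive
    ...   | inj₁ s<t  = contradiction (just-injective (trans (sym (σ-step (reached ex) s<t)) (σ-sym σ-return)))
                                      (a≢d ex s<t ≤-refl)

-- Nonsingular matrices

sumFin-nonzero : ∀ {n} (f : Fin n → ℤ) → sumFin f ≢ + 0 → ∃ λ j → f j ≢ + 0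
sumFin-nonzero {zero}  f sum≢0 = contradiction refl sum≢0
sumFin-nonzero {suc n} f sum≢0 with f zero ℤ.≟ + 0
... | no f₀≢0  = zero , f₀≢0
... | yes f₀≡0
  with j , fⱼ≢0 ← sumFin-nonzero (f ∘ suc) (λ rest≡0 → sum≢0 (cong₂ _+ℤ_ f₀≡0 rest≡0))
  = suc j , fⱼ≢0

factorˡ-nonzero : ∀ x y → x *ℤ y ≢ + 0 → x ≢ + 0
factorˡ-nonzero x y xy≢0 refl = xy≢0 (ℤ.*-zeroˡ y)

factorʳ-nonzero : ∀ x y → x *ℤ y ≢ + 0 → y ≢ + 0
factorʳ-nonzero x y xy≢0 refl = xy≢0 (ℤ.*-zeroʳ x)

-- Some term of the Laplace expansion is nonzero, and it is a product along a permutation.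
det≢0⇒permutation : ∀ {n} (A : Fin n → Fin n → ℤ) → det A ≢ + 0 →
  Σ (Fin n → Fin n) λ π → (∀ i j → π i ≡ π j → i ≡ j) × (∀ i → A i (π i) ≢ + 0)
det≢0⇒permutation {zero}  A _ = (λ ()) , (λ ()) , (λ ())
det≢0⇒permutation {suc n} A det≢0 = π , π-injective , π-nonzero
  where
  term : Fin (suc n) → ℤ
  term j = sgn (toℕ j) *ℤ A zero j *ℤ det (λ i l → A (suc i) (punchIn j l))
  expansion : ∃ λ j → term j ≢ + 0
  expansion = sumFin-nonzero term det≢0
  j : Fin (suc n)
  j = proj₁ expansion
  minor : Fin n → Fin n → ℤ
  minor i l = A (suc i) (punchIn j l)
  term≢0 : sgn (toℕ j) *ℤ A zero j *ℤ det minor ≢ + 0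
  term≢0 = proj₂ expansion
  recursion = det≢0⇒permutation minor (factorʳ-nonzero (sgn (toℕ j) *ℤ A zero j) (det minor) term≢0)
  π′ = proj₁ recursion
  π : Fin (suc n) → Fin (suc n)
  π zero    = j
  π (suc i) = punchIn j (π′ i)
  π-injective : ∀ i i′ → π i ≡ π i′ → i ≡ i′
  π-injective zero     zero     _ = refl
  π-injective zero     (suc i′) e = contradiction (sym e) (punchInᵢ≢i j (π′ i′))
  π-injective (suc i)  zero     e = contradiction e (punchInᵢ≢i j (π′ i))
  π-injective (suc i)  (suc i′) e = cong suc (proj₁ (proj₂ recursion) i i′ (punchIn-injective j _ _ e))
  π-nonzero : ∀ i → A i (π i) ≢ + 0
  π-nonzero zero    = factorʳ-nonzero (sgn (toℕ j)) (A zero j)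
                        (factorˡ-nonzero (sgn (toℕ j) *ℤ A zero j) (det minor) term≢0)
  π-nonzero (suc i) = proj₂ (proj₂ recursion) i

adjMatrix-nonzero : ∀ {n} (G : Graph n) u v → adjMatrix G u v ≢ + 0 → adj G u v ≡ true
adjMatrix-nonzero G u v nonzero with adj G u v
... | true  = refl
... | false = contradiction refl nonzero

-- Gluing maximum matchings of the parts of a partition

partSet-member : ∀ {n m} (part : Fin n → Fin (suc m)) {c v} → partSet part c v ≡ true → part v ≡ c
partSet-member part e = toWitness (Equivalence.from T-≡ e)

partSet-intro : ∀ {n m} (part : Fin n → Fin (suc m)) {c v} → part v ≡ c → partSet part c v ≡ true
partSet-intro part {c} {v} pv≡c with part v ≟ c
... | yes _    = refl
... | no pv≢c = contradiction pv≡c pv≢c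

partSet-nonmember : ∀ {n m} (part : Fin n → Fin (suc m)) {c v} → partSet part c v ≡ false → part v ≢ c
partSet-nonmember part e = toWitnessFalse (Equivalence.from T-not-≡ e)

is-just⇒≢nothing : ∀ {A : Set} {x : Maybe A} → is-just x ≡ true → x ≢ nothing
is-just⇒≢nothing {x = just _} _ ()

≢nothing⇒is-just : ∀ {A : Set} {x : Maybe A} → x ≢ nothing → is-just x ≡ true
≢nothing⇒is-just {x = just _}  _  = refl
≢nothing⇒is-just {x = nothing} x≢ = contradiction refl x≢

module GluedMatching {n m} (G : Graph n) (part : Fin n → Fin (suc m)) {Np : Fin (suc m) → Matching n}
  (Np-maximum : ∀ j → IsMaxMatching G (partSet part j) (Np j))
  (D-neighbour-inside : ∀ j {u v} → InD G (partSet part j) u → adj G u v ≡ true →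
                        partSet part j v ≡ true) where

  glued : Matching n
  glued v = Np (part v) v

  glued-matching : IsMatching G full glued
  glued-matching v u e =
    match-adj e , refl , refl ,
    subst (λ j → Np j u ≡ just v) (sym (partSet-member part (match-inʳ e))) (match-sym e)
    where open MatchingProperties G (proj₁ (Np-maximum (part v)))

  module _ {M : Matching n} (M-matching : IsMatching G full M) where

    private
      module MP = MatchingProperties G M-matching
      module Walk (j : Fin (suc m)) = AlternatingWalk G (Np-maximum j) M
        MP.match-adj MP.match-injective
        (λ u-in-D Mu≡v → D-neighbour-inside j u-in-D (MP.match-adj Mu≡v))
      open Walk.MatchedEnd

      end-of : ∀ v → glued v ≡ nothing → covered M v ≡ true → Walk.MatchedEnd (part v) v
      end-of v free Mv = Walk.matched-end (part v) MP.match-sym (partSet-intro part refl) free (is-just⇒≢nothing Mv)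

      image : ∀ v x → glued v ≡ x → covered M v ≡ true → Fin n
      image v (just _) _    _  = v
      image v nothing  free Mv = end (end-of v free Mv)

      end-part : ∀ v free Mv → part (end (end-of v free Mv)) ≡ part v
      end-part v free Mv = partSet-member part (end-in (end-of v free Mv))

      image-covered : ∀ v x e Mv → covered glued (image v x e Mv) ≡ true
      image-covered v (just _) e    Mv = cong is-just e
      image-covered v nothing  free Mv = ≢nothing⇒is-just
        (subst (λ j → Np j w ≢ nothing) (sym (end-part v free Mv)) (end-matched (end-of v free Mv)))
        where w = end (end-of v free Mv)

      ends-injective : ∀ j j′ → j ≡ j′ → ∀ {z z′} → Np j z ≡ nothing → Np j′ z′ ≡ nothing →
        (E : Walk.MatchedEnd j z) (E′ : Walk.MatchedEnd j′ z′) → end E ≡ end E′ → z ≡ z′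
      ends-injective j .j refl z-free z′-free E E′ same-end =
        proj₁ (Walk.walk-backward-unique j (length E) (length E′) z-free z′-free
                 (walk-end E) (trans (walk-end E′) (cong just (sym same-end))))

      image-injective : ∀ v v′ x x′ e e′ Mv Mv′ → image v x e Mv ≡ image v′ x′ e′ Mv′ → v ≡ v′
      image-injective v v′ (just _) (just _) _ _ _ _ v≡v′ = v≡v′
      image-injective v v′ (just _) nothing _ free′ Mv Mv′ v≡end′ =
        contradiction (trans (cong M v≡end′) (end-σ-free (end-of v′ free′ Mv′))) (is-just⇒≢nothing Mv)
      image-injective v v′ nothing (just _) free _ Mv Mv′ end≡v′ =
        contradiction (trans (cong M (sym end≡v′)) (end-σ-free (end-of v free Mv))) (is-just⇒≢nothing Mv′)
      image-injective v v′ nothing nothing free free′ Mv Mv′ same-end =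
        ends-injective (part v) (part v′)
          (trans (sym (end-part v free Mv)) (trans (cong part same-end) (end-part v′ free′ Mv′)))
          free free′ (end-of v free Mv) (end-of v′ free′ Mv′) same-end

    #covered-≤ : #covered M ≤ #covered glued
    #covered-≤ = count-≤-injection (covered M) (covered glued)
      (λ v → image v (glued v) refl) (λ v → image-covered v (glued v) refl)
      (λ v v′ → image-injective v v′ (glued v) (glued v′) refl refl)

    msize-≤ : msize M ≤ msize glued
    msize-≤ = *-cancelˡ-≤ 2 (subst₂ _≤_ (sym MP.2*msize≡#covered)
      (sym (MatchingProperties.2*msize≡#covered G glued-matching)) #covered-≤)

  glued-maximum : IsMaxMatching G full glued
  glued-maximum = glued-matching , λ M M-matching → msize-≤ M-matching

deficiency-unique : ∀ {n} (G : Graph n) {S M M′} → IsMaxMatching G S M → IsMaxMatching G S M′ →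
  deficiency S M ≡ deficiency S M′
deficiency-unique G {S} (M-matching , M-max) (M′-matching , M′-max) =
  cong (λ size → count S ∸ 2 * size) (≤-antisym (M′-max _ M-matching) (M-max _ M′-matching))

-- BAB-graphs

record Deficient {n} (G : Graph n) (S : VSet n) : Set where
  field
    matching       : Matching n
    maximum        : IsMaxMatching G S matching
    uncovered      : Fin n
    uncovered-in   : S uncovered ≡ true
    uncovered-free : matching uncovered ≡ nothing

flowers⇒deficient : ∀ {n} {G : Graph n} {S} {C : Cycle G S} → FlowerCovered G S C → Deficient G S
flowers⇒deficient {C = C} flowers
  with M , M-maximum , _ , _ , _ , stem , _ ← flowers (vtx C zero) (inS C zero) = record
  { matching = M ; maximum = M-maximum
  ; uncovered = p stem (fromℕ _) ; uncovered-in = inS stem _ ; uncovered-free = endFree stem }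

module BABGraph {n k} {G : Graph n} {part : Fin n → Fin (suc k)} (bab : IsBAB G k part) where

  open IsBAB bab

  private
    crossing-not-D : ∀ j {u v} → adj G u v ≡ true → part u ≡ j → part v ≢ j → ¬ InD G (partSet part j) u
    crossing-not-D zero    uv pu≡j pv≢j with crossB _ _ uv (λ pu≡pv → pv≢j (trans (sym pu≡pv) pu≡j)) pu≡j
    ... | inj₁ u-in-A = proj₁ (proj₂ u-in-A)
    ... | inj₂ u-in-C = proj₁ (proj₂ u-in-C)
    crossing-not-D (suc i) uv pu≡j pv≢j =
      proj₁ (proj₂ (crossG _ _ uv (λ pu≡pv → pv≢j (trans (sym pu≡pv) pu≡j)) i pu≡j))

  D-neighbour-inside : ∀ j {u v} → InD G (partSet part j) u → adj G u v ≡ true → partSet part j v ≡ true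
  D-neighbour-inside j {u} {v} u-in-D uv with partSet part j v in e
  ... | true  = refl
  ... | false = contradiction u-in-D
                  (crossing-not-D j uv (partSet-member part (proj₁ u-in-D)) (partSet-nonmember part e))

module BABMatching {n k} {G : Graph n} {part : Fin n → Fin (suc k)} (bab : IsBAB G k part)
  {MB : Matching n} (MB-maximum : IsMaxMatching G (partSet part zero) MB)
  (π : Fin n → Fin n) (π-injective : ∀ u v → π u ≡ π v → u ≡ v)
  (π-adj : ∀ v → adj G v (π v) ≡ true) where

  open IsBAB bab
  open BABGraph bab

  B : VSet n
  B = partSet part zero

  component : (i : Fin k) → Deficient G (partSet part (suc i))
  component i = flowers⇒deficient (flowers i)

  open Deficient

  Np : Fin (suc k) → Matching n
  Np zero    = MB
  Np (suc i) = matching (component i)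

  Np-maximum : ∀ j → IsMaxMatching G (partSet part j) (Np j)
  Np-maximum zero    = MB-maximum
  Np-maximum (suc i) = maximum (component i)

  open GluedMatching G part Np-maximum D-neighbour-inside public

  uncovered-unique : ∀ i {v v′} → partSet part (suc i) v ≡ true → partSet part (suc i) v′ ≡ true →
    Np (suc i) v ≡ nothing → Np (suc i) v′ ≡ nothing → v ≡ v′
  uncovered-unique i = free-vertex-unique (λ v ()) {oddCyc i} (almostBip i)
    where
    σ-adj : ∀ {u v} → just (π u) ≡ just v → adj G u v ≡ true
    σ-adj {u} e = subst (λ x → adj G u x ≡ true) (just-injective e) (π-adj u)
    open AlternatingWalk G (Np-maximum (suc i)) (just ∘ π) σ-adj
      (λ e e′ → π-injective _ _ (just-injective (trans e (sym e′))))
      (λ u-in-D e → D-neighbour-inside (suc i) u-in-D (σ-adj e))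

  uncovered-in-B : count (λ v → not (covered glued v) ∧ B v) ≡ deficiency B MB
  uncovered-in-B = trans (count-cong agree) (sym (MatchingProperties.deficiency≡#uncovered G (proj₁ MB-maximum)))
    where
    agree : ∀ v → not (covered glued v) ∧ B v ≡ B v ∧ not (covered MB v)
    agree v with B v in e
    ... | false = ∧-zeroʳ _
    ... | true rewrite partSet-member part e = ∧-identityʳ _

  private
    uncovered-outside : Fin n → Bool
    uncovered-outside v = not (covered glued v) ∧ not (B v)

    outside-free : ∀ v → uncovered-outside v ≡ true → glued v ≡ nothing × part v ≢ zero
    outside-free v p with glued v | B v in e
    ... | nothing | false = refl , partSet-nonmember part e
    outside-free v () | just _  | _
    outside-free v () | nothing | true

    index : ∀ v → uncovered-outside v ≡ true → Fin k
    index v p = punchOut (≢-sym (proj₂ (outside-free v p)))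

    index-part : ∀ v p → part v ≡ suc (index v p)
    index-part v p = sym (punchIn-punchOut (≢-sym (proj₂ (outside-free v p))))

    index-injective : ∀ v v′ p p′ → index v p ≡ index v′ p′ → v ≡ v′
    index-injective v v′ p p′ e = uncovered-unique (index v p)
      (partSet-intro part (index-part v p)) (partSet-intro part part-v′)
      (subst (λ j → Np j v ≡ nothing) (index-part v p) (proj₁ (outside-free v p)))
      (subst (λ j → Np j v′ ≡ nothing) part-v′ (proj₁ (outside-free v′ p′)))
      where
      part-v′ : part v′ ≡ suc (index v p)
      part-v′ = trans (index-part v′ p′) (cong suc (sym e))

    free-part : ∀ i → part (uncovered (component i)) ≡ suc i
    free-part i = partSet-member part (uncovered-in (component i))

    free-outside : ∀ i → uncovered-outside (uncovered (component i)) ≡ true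
    free-outside i rewrite free-part i | uncovered-free (component i) = refl

    free-injective : ∀ i i′ → uncovered (component i) ≡ uncovered (component i′) → i ≡ i′
    free-injective i i′ e = suc-injective (trans (sym (free-part i)) (trans (cong part e) (free-part i′)))

  uncovered-outside-B : count (λ v → not (covered glued v) ∧ not (B v)) ≡ k
  uncovered-outside-B = ≤-antisym
    (≤-trans (count-≤-injection uncovered-outside (λ _ → true) index (λ _ _ → refl) index-injective)
             (≤-reflexive (count-true k)))
    (≤-trans (≤-reflexive (sym (count-true k)))
             (count-≤-injection (λ _ → true) uncovered-outside (λ i _ → uncovered (component i))
               (λ i _ → free-outside i) (λ i i′ _ _ → free-injective i i′)))

mainTheorem20 : ∀ {n} (G : Graph n) (k : ℕ) (part : Fin n → Fin (suc k))
    → IsBAB G k part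
    → det (adjMatrix G) ≢ + 0
    → (MG MB : Matching n)
    → IsMaxMatching G full MG
    → IsMaxMatching G (partSet part zero) MB
    → deficiency full MG ≡ deficiency (partSet part zero) MB + k
mainTheorem20 G k part bab det≢0 MG MB MG-maximum MB-maximum = begin
  deficiency full MG
    ≡⟨ deficiency-unique G MG-maximum glued-maximum ⟩
  deficiency full glued
    ≡⟨ deficiency≡#uncovered ⟩
  count (λ v → not (covered glued v))
    ≡⟨ count-split _ B ⟩
  count (λ v → not (covered glued v) ∧ B v) + count (λ v → not (covered glued v) ∧ not (B v))
    ≡⟨ cong₂ _+_ uncovered-in-B uncovered-outside-B ⟩
  deficiency B MB + k
    ∎
  where
  open ≡-Reasoning
  π-data = det≢0⇒permutation (adjMatrix G) det≢0
  open BABMatching bab MB-maximum (proj₁ π-data) (proj₁ (proj₂ π-data))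
    (λ v → adjMatrix-nonzero G v _ (proj₂ (proj₂ π-data) v))
  open MatchingProperties G glued-matching using (deficiency≡#uncovered)
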